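{- Let $a,b,c,q$ be indeterminates, $\mathbf L(a,b,c)$ the lower-bidiagonal matrix with diagonal entries $ka+b$ ($k\ge0$) and $(k,k-1)$ entries $kc$ ($k\ge1$), and $\mathbf B_q=[\binom nkq^{n-k}]_{n,k\ge0}$. Then (i) $\mathbf B_q^{ -1}\mathbf L(a,b,c)\mathbf B_q$ is the lower-bidiagonal matrix with diagonal entries $ka+b$ ($k\ge0$) and $(k,k-1)$ entries $k(qa+c)$ ($k\ge1$); (ii) $\mathbf B_q^{ -1}\mathbf L(a,b,c)\mathbf B_q$ is coefficientwise totally positive in $(a,b,c,q)$.
   Context: A matrix with polynomial entries is coefficientwise totally positive in given indeterminates if all its minors are polynomials in them with nonnegative coefficients. -}

module Defs where

open import Data.Nat as ℕ using (ℕ; zero; suc; _∸_; _≟_)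
open import Data.Nat.Combinatorics using (_C_)
open import Data.Integer as ℤ using (ℤ; +_; -[1+_])
open import Data.Fin using (Fin; toℕ; punchIn)
import Data.Fin as F
open import Relation.Nullary using (yes; no)
open import Relation.Binary.PropositionalEquality using (_≡_)

-- Formal power series in four commuting indeterminates a, b, c, q with
-- integer coefficients:  f i j k l  is the coefficient of a^i b^j c^k q^l.
-- (The polynomial ring ℤ[a,b,c,q] embeds in this ring; all entries and
-- minors considered here are polynomials.)

Ser : Set
Ser = ℕ → ℕ → ℕ → ℕ → ℤ

sumℤ : ℕ → (ℕ → ℤ) → ℤ
sumℤ zero    h = h 0
sumℤ (suc n) h = sumℤ n h ℤ.+ h (suc n)

0S : Ser
0S _ _ _ _ = + 0

1S : Ser
1S zero zero zero zero = + 1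
1S _    _    _    _    = + 0

constS : ℤ → Ser
constS z zero zero zero zero = z
constS z _    _    _    _    = + 0

infixl 6 _+S_
infixl 7 _*S_

_+S_ : Ser → Ser → Ser
(f +S g) i j k l = f i j k l ℤ.+ g i j k l

-S_ : Ser → Ser
(-S f) i j k l = ℤ.- f i j k l

_*S_ : Ser → Ser → Ser
(f *S g) i j k l =
  sumℤ i λ i₁ → sumℤ j λ j₁ → sumℤ k λ k₁ → sumℤ l λ l₁ →
    f i₁ j₁ k₁ l₁ ℤ.* g (i ∸ i₁) (j ∸ j₁) (k ∸ k₁) (l ∸ l₁)

_^S_ : Ser → ℕ → Ser
f ^S zero  = 1S
f ^S suc n = f *S (f ^S n)

_·S_ : ℕ → Ser → Ser
n ·S f = constS (+ n) *S f

varA varB varC varQ : Ser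
varA (suc zero) zero zero zero = + 1
varA _ _ _ _ = + 0
varB zero (suc zero) zero zero = + 1
varB _ _ _ _ = + 0
varC zero zero (suc zero) zero = + 1
varC _ _ _ _ = + 0
varQ zero zero zero (suc zero) = + 1
varQ _ _ _ _ = + 0

_≈S_ : Ser → Ser → Set
f ≈S g = ∀ i j k l → f i j k l ≡ g i j k l

NonNegCoeffs : Ser → Set
NonNegCoeffs f = ∀ i j k l → + 0 ℤ.≤ f i j k l

Mat : Set
Mat = ℕ → ℕ → Ser

sumS : ℕ → (ℕ → Ser) → Ser
sumS n h i j k l = sumℤ n λ m → h m i j k l

-- Product  (M ⋆ N) n k = Σ_{j=0}^{n} M n j N j k.
-- For lower-triangular M this is exactly the usual matrix product
-- (the terms with j > n vanish), so it is the product used in the paper.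
_⋆_ : Mat → Mat → Mat
(M ⋆ N) n k = sumS n λ j → M n j *S N j k

_≈M_ : Mat → Mat → Set
M ≈M N = ∀ n k → M n k ≈S N n k

LowerTriangular : Mat → Set
LowerTriangular M = ∀ n k → n ℕ.< k → M n k ≈S 0S

IdMat : Mat
IdMat n k with n ≟ k
... | yes _ = 1S
... | no  _ = 0S

Lbidiag : Ser → Ser → Ser → Mat
Lbidiag x y z n k with n ≟ k | n ≟ suc k
... | yes _ | _     = (n ·S x) +S y
... | no _  | yes _ = n ·S z
... | no _  | no _  = 0S

Bq : Mat
Bq n k = (n C k) ·S (varQ ^S (n ∸ k))

sumFin : ∀ {m} → (Fin m → Ser) → Ser
sumFin {zero}  h = 0S
sumFin {suc m} h = h F.zero +S sumFin (λ j → h (F.suc j))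

signS : ℕ → Ser
signS zero          = 1S
signS (suc zero)    = constS -[1+ 0 ]
signS (suc (suc n)) = signS n

det : ∀ m → (Fin m → Fin m → Ser) → Ser
det zero    M = 1S
det (suc m) M = sumFin λ j →
  signS (toℕ j) *S M F.zero j *S det m (λ r s → M (F.suc r) (punchIn j s))

StrictlyIncreasing : ∀ {m} → (Fin m → ℕ) → Set
StrictlyIncreasing {m} r = ∀ (i j : Fin m) → i F.< j → r i ℕ.< r j

minor : Mat → ∀ m → (Fin m → ℕ) → (Fin m → ℕ) → Ser
minor M m r c = det m (λ i j → M (r i) (c j))

CoeffwiseTP : Mat → Set
CoeffwiseTP M = ∀ m (r c : Fin m → ℕ) → StrictlyIncreasing r →
  StrictlyIncreasing c → NonNegCoeffs (minor M m r c)

{-# OPTIONS --safe #-}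
module Submission where

-- Binomial coefficients satisfy (m+1)·C(m,k) = (k+1)·C(m+1,k+1) and
-- (m+1)·C(m+1,k) = k·C(m+1,k) + (k+1)·C(m+1,k+1). Since L is bidiagonal, entry
-- (m+1,k) of L(a,b,c) B_q and of B_q L(a,b,qa+c) has only two nonzero terms, and
-- these identities make them agree; so L(a,b,c) B_q = B_q L(a,b,qa+c), and
-- multiplying by a left inverse of B_q proves (i). For (ii), expand a minor of a lower-
-- bidiagonal matrix along its first row: the entry in the first column times a
-- smaller minor survives, while every other term vanishes, because either its
-- entry lies above the diagonal or its cofactor has a first column lying at least
-- two steps below the diagonal. By induction every minor equals a product of
-- entries, hence has nonnegative coefficients when the entries do.

open import Algebra.Bundles using (CommutativeSemiring; CommutativeRing)
open import Algebra.Structures using (IsCommutativeRing)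
open import Data.Empty using (⊥-elim)
open import Data.Fin as F using (Fin; toℕ; punchIn)
open import Data.Integer as ℤ using (ℤ; +_)
import Data.Integer.Properties as ℤₚ
open import Data.Nat as ℕ using (ℕ; zero; suc; _∸_; _≤_; _<_; z≤n; s≤s; s≤s⁻¹; _≟_)
open import Data.Nat.Combinatorics using (_C_; nC1≡n; nCk+nC[k+1]≡[n+1]C[k+1])
open import Data.Nat.Combinatorics.Specification using (k>n⇒nCk≡0)
open import Data.Nat.Properties
  using ( ≤-refl; m≤n⇒m≤1+n; <⇒≢; ≤∧≢⇒<; suc-injective; <-cmp; m≤n+m; +-suc
        ; +-∸-assoc; ∸-+-assoc; n∸n≡0; m∸n+n≡m; m+[n∸m]≡n; m∸[m∸n]≡n; m+n∸m≡n )
import Data.Nat.Properties as ℕₚ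
open import Data.Product using (_×_; _,_; proj₁)
open import Function using (_∘_)
open import Level using (0ℓ)
open import Relation.Binary.Definitions using (tri<; tri≈; tri>)
open import Relation.Binary.PropositionalEquality as ≡ using (_≡_; _≢_)
open import Relation.Nullary using (yes; no)

module FiniteSum {c ℓ} (R : CommutativeSemiring c ℓ) where
  open CommutativeSemiring R hiding (zero)
  open import Algebra.Properties.CommutativeSemigroup +-commutativeSemigroup using (interchange)
  open import Relation.Binary.Reasoning.Setoid setoid

  sum : ℕ → (ℕ → Carrier) → Carrier
  sum zero    h = h 0
  sum (suc n) h = sum n h + h (suc n)

  sum-cong-≤ : ∀ n {h g} → (∀ i → i ≤ n → h i ≈ g i) → sum n h ≈ sum n g
  sum-cong-≤ zero    h≈g = h≈g 0 z≤n
  sum-cong-≤ (suc n) h≈g = +-cong (sum-cong-≤ n (λ i i≤n → h≈g i (m≤n⇒m≤1+n i≤n))) (h≈g (suc n) ≤-refl)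

  sum-cong : ∀ n {h g} → (∀ i → h i ≈ g i) → sum n h ≈ sum n g
  sum-cong n h≈g = sum-cong-≤ n (λ i _ → h≈g i)

  sum-zero : ∀ n {h} → (∀ i → i ≤ n → h i ≈ 0#) → sum n h ≈ 0#
  sum-zero n {h} h≈0 = trans (sum-cong-≤ n h≈0) (sum-0# n)
    where
    sum-0# : ∀ n → sum n (λ _ → 0#) ≈ 0#
    sum-0# zero    = refl
    sum-0# (suc n) = trans (+-identityʳ _) (sum-0# n)

  sum-distrib-+ : ∀ n h g → sum n (λ i → h i + g i) ≈ sum n h + sum n g
  sum-distrib-+ zero    h g = refl
  sum-distrib-+ (suc n) h g = trans (+-congʳ (sum-distrib-+ n h g)) (interchange _ _ _ _)

  *-distribˡ-sum : ∀ n x h → x * sum n h ≈ sum n (λ i → x * h i)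
  *-distribˡ-sum zero    x h = refl
  *-distribˡ-sum (suc n) x h = trans (distribˡ x _ _) (+-congʳ (*-distribˡ-sum n x h))

  *-distribʳ-sum : ∀ n x h → sum n h * x ≈ sum n (λ i → h i * x)
  *-distribʳ-sum zero    x h = refl
  *-distribʳ-sum (suc n) x h = trans (distribʳ x _ _) (+-congʳ (*-distribʳ-sum n x h))

  sum-comm : ∀ n m (f : ℕ → ℕ → Carrier) → sum n (λ i → sum m (f i)) ≈ sum m (λ j → sum n (λ i → f i j))
  sum-comm zero    m f = refl
  sum-comm (suc n) m f = trans (+-congʳ (sum-comm n m f)) (sym (sum-distrib-+ m _ _))

  sum-suc : ∀ n h → sum (suc n) h ≈ h 0 + sum n (h ∘ suc)
  sum-suc zero    h = refl
  sum-suc (suc n) h = trans (+-congʳ (sum-suc n h)) (+-assoc _ _ _)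

  sum-reverse : ∀ n h → sum n h ≈ sum n (λ i → h (n ∸ i))
  sum-reverse zero    h = refl
  sum-reverse (suc n) h = begin
    sum (suc n) h                        ≈⟨ sum-suc n h ⟩
    h 0 + sum n (h ∘ suc)                ≈⟨ +-congˡ (sum-reverse n (h ∘ suc)) ⟩
    h 0 + sum n (λ i → h (suc (n ∸ i)))  ≈⟨ +-comm _ _ ⟩
    sum n (λ i → h (suc (n ∸ i))) + h 0  ≈⟨ +-cong (sum-cong-≤ n λ i i≤n → reflexive (≡.cong h (≡.sym (+-∸-assoc 1 i≤n))))
                                                   (reflexive (≡.cong h (≡.sym (n∸n≡0 n)))) ⟩
    sum (suc n) (λ i → h (suc n ∸ i))    ∎

  sum-truncate : ∀ n N {h} → n ≤ N → (∀ i → n < i → h i ≈ 0#) → sum N h ≈ sum n h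
  sum-truncate n N {h} n≤N h≈0 = begin
    sum N h                ≡⟨ ≡.cong (λ m → sum m h) (≡.sym (m∸n+n≡m n≤N)) ⟩
    sum (N ∸ n ℕ.+ n) h    ≈⟨ extend (N ∸ n) ⟩
    sum n h                ∎
    where
    extend : ∀ d → sum (d ℕ.+ n) h ≈ sum n h
    extend zero    = refl
    extend (suc d) = trans (+-cong (extend d) (h≈0 _ (s≤s (m≤n+m n d)))) (+-identityʳ _)

  sum-single : ∀ N a {h} → a ≤ N → (∀ i → i ≤ N → i ≢ a → h i ≈ 0#) → sum N h ≈ h a
  sum-single zero    .zero z≤n h≈0 = refl
  sum-single (suc N) a   a≤N h≈0 with a ≟ suc N
  ... | yes ≡.refl = trans (+-congʳ (sum-zero N λ i i≤N → h≈0 i (m≤n⇒m≤1+n i≤N) (<⇒≢ (s≤s i≤N))))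
                           (+-identityˡ _)
  ... | no  a≢1+N  = trans (+-cong (sum-single N a (s≤s⁻¹ (≤∧≢⇒< a≤N a≢1+N)) λ i i≤N → h≈0 i (m≤n⇒m≤1+n i≤N))
                                   (h≈0 (suc N) ≤-refl (a≢1+N ∘ ≡.sym)))
                           (+-identityʳ _)

  sum-pair : ∀ N a {h} → suc a ≤ N → (∀ i → i ≤ N → i ≢ a → i ≢ suc a → h i ≈ 0#) → sum N h ≈ h a + h (suc a)
  sum-pair (suc N) a (s≤s a≤N) h≈0 with a ≟ N
  ... | yes ≡.refl = +-congʳ (sum-single N a a≤N λ i i≤N i≢a → h≈0 i (m≤n⇒m≤1+n i≤N) i≢a (<⇒≢ (s≤s i≤N)))
  ... | no  a≢N    = trans (+-cong (sum-pair N a a<N λ i i≤N → h≈0 i (m≤n⇒m≤1+n i≤N))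
                                   (h≈0 (suc N) ≤-refl (<⇒≢ (m≤n⇒m≤1+n a<N) ∘ ≡.sym) (a≢N ∘ ≡.sym ∘ suc-injective)))
                           (+-identityʳ _)
    where
    a<N : a < N
    a<N = ≤∧≢⇒< a≤N a≢N

  sum-triangle : ∀ n (f : ℕ → ℕ → Carrier) →
                 sum n (λ i → sum i (f i)) ≈ sum n (λ j → sum (n ∸ j) (λ m → f (j ℕ.+ m) j))
  sum-triangle zero    f = refl
  sum-triangle (suc n) f = begin
    sum n (λ i → sum i (f i)) + (sum n (f (suc n)) + f (suc n) (suc n))
      ≈⟨ trans (+-congʳ (sum-triangle n f)) (sym (+-assoc _ _ _)) ⟩
    (sum n (λ j → sum (n ∸ j) (column j)) + sum n (f (suc n))) + f (suc n) (suc n)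
      ≈⟨ +-cong (sym (sum-distrib-+ n _ _)) (reflexive (≡.cong (λ t → f t (suc n)) (≡.sym (ℕₚ.+-identityʳ (suc n))))) ⟩
    sum n (λ j → sum (n ∸ j) (column j) + f (suc n) j) + column (suc n) 0
      ≈⟨ +-cong (sum-cong-≤ n extend) (reflexive (≡.cong (λ t → sum t (column (suc n))) (≡.sym (n∸n≡0 n)))) ⟩
    sum (suc n) (λ j → sum (suc n ∸ j) (column j))
      ∎
    where
    column : ℕ → ℕ → Carrier
    column j m = f (j ℕ.+ m) j

    extend : ∀ j → j ≤ n → sum (n ∸ j) (column j) + f (suc n) j ≈ sum (suc n ∸ j) (column j)
    extend j j≤n = begin
      sum (n ∸ j) (column j) + f (suc n) j   ≡⟨ ≡.cong (λ t → sum (n ∸ j) (column j) + f t j) (≡.sym j+[1+n∸j]≡1+n) ⟩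
      sum (suc (n ∸ j)) (column j)           ≡⟨ ≡.cong (λ t → sum t (column j)) (≡.sym (+-∸-assoc 1 j≤n)) ⟩
      sum (suc n ∸ j) (column j)             ∎
      where
      j+[1+n∸j]≡1+n : j ℕ.+ suc (n ∸ j) ≡ suc n
      j+[1+n∸j]≡1+n = ≡.trans (+-suc j (n ∸ j)) (≡.cong suc (m+[n∸m]≡n j≤n))

module PowerSeries {c ℓ} (R : CommutativeRing c ℓ) where
  open CommutativeRing R hiding (zero; isCommutativeRing)
  open FiniteSum commutativeSemiring
  open import Relation.Binary.Reasoning.Setoid setoid

  Series : Set c
  Series = ℕ → Carrier

  infix  4 _≈ₛ_
  infixl 6 _+ₛ_
  infixl 7 _*ₛ_

  _≈ₛ_ : Series → Series → Set ℓ
  f ≈ₛ g = ∀ n → f n ≈ g n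

  _+ₛ_ : Series → Series → Series
  (f +ₛ g) n = f n + g n

  -ₛ_ : Series → Series
  (-ₛ f) n = - f n

  0ₛ : Series
  0ₛ _ = 0#

  1ₛ : Series
  1ₛ zero    = 1#
  1ₛ (suc _) = 0#

  _*ₛ_ : Series → Series → Series
  (f *ₛ g) n = sum n (λ i → f i * g (n ∸ i))

  *ₛ-cong : ∀ {f f′ g g′} → f ≈ₛ f′ → g ≈ₛ g′ → f *ₛ g ≈ₛ f′ *ₛ g′
  *ₛ-cong f≈f′ g≈g′ n = sum-cong n (λ i → *-cong (f≈f′ i) (g≈g′ (n ∸ i)))

  *ₛ-comm : ∀ f g → f *ₛ g ≈ₛ g *ₛ f
  *ₛ-comm f g n = trans (sum-reverse n _)
    (sum-cong-≤ n (λ i i≤n → trans (*-comm _ _) (*-congʳ (reflexive (≡.cong g (m∸[m∸n]≡n i≤n))))))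

  *ₛ-assoc : ∀ f g h → (f *ₛ g) *ₛ h ≈ₛ f *ₛ (g *ₛ h)
  *ₛ-assoc f g h n = begin
    sum n (λ i → sum i (λ j → f j * g (i ∸ j)) * h (n ∸ i))
      ≈⟨ sum-cong n (λ i → *-distribʳ-sum i _ _) ⟩
    sum n (λ i → sum i (λ j → f j * g (i ∸ j) * h (n ∸ i)))
      ≈⟨ sum-triangle n _ ⟩
    sum n (λ j → sum (n ∸ j) (λ m → f j * g (j ℕ.+ m ∸ j) * h (n ∸ (j ℕ.+ m))))
      ≈⟨ sum-cong n (λ j → sum-cong (n ∸ j) (λ m → trans (*-assoc _ _ _)
           (*-congˡ (*-cong (reflexive (≡.cong g (m+n∸m≡n j m))) (reflexive (≡.cong h (≡.sym (∸-+-assoc n j m)))))))) ⟩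
    sum n (λ j → sum (n ∸ j) (λ m → f j * (g m * h (n ∸ j ∸ m))))
      ≈⟨ sum-cong n (λ j → sym (*-distribˡ-sum (n ∸ j) _ _)) ⟩
    sum n (λ j → f j * sum (n ∸ j) (λ m → g m * h (n ∸ j ∸ m)))
      ∎

  *ₛ-identityˡ : ∀ f → 1ₛ *ₛ f ≈ₛ f
  *ₛ-identityˡ f zero    = *-identityˡ _
  *ₛ-identityˡ f (suc n) =
    trans (sum-suc n _) (trans (+-cong (*-identityˡ _) (sum-zero n (λ i _ → zeroˡ _))) (+-identityʳ _))

  *ₛ-distribˡ-+ₛ : ∀ f g h → f *ₛ (g +ₛ h) ≈ₛ f *ₛ g +ₛ f *ₛ h
  *ₛ-distribˡ-+ₛ f g h n = trans (sum-cong n (λ i → distribˡ _ _ _)) (sum-distrib-+ n _ _)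

  isCommutativeRing : IsCommutativeRing _≈ₛ_ _+ₛ_ _*ₛ_ -ₛ_ 0ₛ 1ₛ
  isCommutativeRing = record
    { isRing = record
      { +-isAbelianGroup = record
        { isGroup = record
          { isMonoid = record
            { isSemigroup = record
              { isMagma = record
                { isEquivalence = record
                  { refl = λ n → refl ; sym = λ p n → sym (p n) ; trans = λ p q n → trans (p n) (q n) }
                ; ∙-cong = λ p q n → +-cong (p n) (q n) }
              ; assoc = λ f g h n → +-assoc _ _ _ }
            ; identity = (λ f n → +-identityˡ _) , (λ f n → +-identityʳ _) }
          ; inverse = (λ f n → -‿inverseˡ _) , (λ f n → -‿inverseʳ _)
          ; ⁻¹-cong = λ p n → -‿cong (p n) }
        ; comm = λ f g n → +-comm _ _ }
      ; *-cong = *ₛ-cong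
      ; *-assoc = *ₛ-assoc
      ; *-identity = *ₛ-identityˡ , λ f n → trans (*ₛ-comm f 1ₛ n) (*ₛ-identityˡ f n)
      ; distrib = *ₛ-distribˡ-+ₛ , λ f g h n →
          trans (*ₛ-comm (g +ₛ h) f n) (trans (*ₛ-distribˡ-+ₛ f g h n) (+-cong (*ₛ-comm f g n) (*ₛ-comm f h n))) }
    ; *-comm = *ₛ-comm }

  commutativeRing : CommutativeRing c ℓ
  commutativeRing = record { isCommutativeRing = isCommutativeRing }

  sum-apply : ∀ n (h : ℕ → Series) m →
              FiniteSum.sum (CommutativeRing.commutativeSemiring commutativeRing) n h m ≡ sum n (λ i → h i m)
  sum-apply zero    h m = ≡.refl
  sum-apply (suc n) h m = ≡.cong (_+ h (suc n) m) (sum-apply n h m)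

module _ {c ℓ} (R : CommutativeRing c ℓ) where
  open CommutativeRing R
  open import Relation.Binary.Reasoning.Setoid setoid

  isCommutativeRing-replace-* : (_∙_ : Carrier → Carrier → Carrier) (e : Carrier) →
    (∀ x y → (x ∙ y) ≈ x * y) → e ≈ 1# → IsCommutativeRing _≈_ _+_ _∙_ -_ 0# e
  isCommutativeRing-replace-* _∙_ e ∙≈* e≈1 = record
    { isRing = record
      { +-isAbelianGroup = +-isAbelianGroup
      ; *-cong = λ {x} {x′} {y} {y′} x≈x′ y≈y′ → trans (∙≈* x y) (trans (*-cong x≈x′ y≈y′) (sym (∙≈* x′ y′)))
      ; *-assoc = λ x y z → begin
          (x ∙ y) ∙ z   ≈⟨ ∙≈* _ _ ⟩
          (x ∙ y) * z   ≈⟨ *-congʳ (∙≈* x y) ⟩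
          (x * y) * z   ≈⟨ *-assoc x y z ⟩
          x * (y * z)   ≈⟨ *-congˡ (∙≈* y z) ⟨
          x * (y ∙ z)   ≈⟨ ∙≈* _ _ ⟨
          x ∙ (y ∙ z)   ∎
      ; *-identity = (λ x → trans (∙≈* e x) (trans (*-congʳ e≈1) (*-identityˡ x)))
                   , (λ x → trans (∙≈* x e) (trans (*-congˡ e≈1) (*-identityʳ x)))
      ; distrib = (λ x y z → trans (∙≈* x _) (trans (distribˡ x y z) (+-cong (sym (∙≈* x y)) (sym (∙≈* x z)))))
                , (λ x y z → trans (∙≈* _ x) (trans (distribʳ x y z) (+-cong (sym (∙≈* y x)) (sym (∙≈* z x)))))
      }
    ; *-comm = λ x y → trans (∙≈* x y) (trans (*-comm x y) (sym (∙≈* y x)))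
    }

[1+k]*[1+n]C[1+k]≡[1+n]*nCk : ∀ n k → suc k ℕ.* (suc n C suc k) ≡ suc n ℕ.* (n C k)
[1+k]*[1+n]C[1+k]≡[1+n]*nCk zero    zero    = ≡.refl
[1+k]*[1+n]C[1+k]≡[1+n]*nCk zero    (suc k) = ℕₚ.*-zeroʳ (suc (suc k))
[1+k]*[1+n]C[1+k]≡[1+n]*nCk (suc n) zero    =
  ≡.trans (ℕₚ.*-identityˡ _) (≡.trans (nC1≡n (suc (suc n))) (≡.sym (ℕₚ.*-identityʳ _)))
[1+k]*[1+n]C[1+k]≡[1+n]*nCk (suc n) (suc k) = begin
  suc (suc k) ℕ.* (suc (suc n) C suc (suc k))
    ≡⟨ ≡.cong (suc (suc k) ℕ.*_) (≡.sym (nCk+nC[k+1]≡[n+1]C[k+1] (suc n) (suc k))) ⟩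
  suc (suc k) ℕ.* (X ℕ.+ Y)
    ≡⟨ ℕₚ.*-distribˡ-+ (suc (suc k)) X Y ⟩
  (X ℕ.+ suc k ℕ.* X) ℕ.+ suc (suc k) ℕ.* Y
    ≡⟨ ℕₚ.+-assoc X _ _ ⟩
  X ℕ.+ (suc k ℕ.* X ℕ.+ suc (suc k) ℕ.* Y)
    ≡⟨ ≡.cong₂ (λ u v → X ℕ.+ (u ℕ.+ v)) ([1+k]*[1+n]C[1+k]≡[1+n]*nCk n k) ([1+k]*[1+n]C[1+k]≡[1+n]*nCk n (suc k)) ⟩
  X ℕ.+ (suc n ℕ.* (n C k) ℕ.+ suc n ℕ.* (n C suc k))
    ≡⟨ ≡.cong (X ℕ.+_) (≡.sym (ℕₚ.*-distribˡ-+ (suc n) (n C k) (n C suc k))) ⟩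
  X ℕ.+ suc n ℕ.* (n C k ℕ.+ n C suc k)
    ≡⟨ ≡.cong (λ u → X ℕ.+ suc n ℕ.* u) (nCk+nC[k+1]≡[n+1]C[k+1] n k) ⟩
  suc (suc n) ℕ.* X
    ∎
  where
  open ≡.≡-Reasoning
  X Y : ℕ
  X = suc n C suc k
  Y = suc n C suc (suc k)

[1+n]*[1+n]Ck≡k*[1+n]Ck+[1+k]*[1+n]C[1+k] : ∀ n k → suc n ℕ.* (suc n C k) ≡ k ℕ.* (suc n C k) ℕ.+ suc k ℕ.* (suc n C suc k)
[1+n]*[1+n]Ck≡k*[1+n]Ck+[1+k]*[1+n]C[1+k] n zero    = ≡.sym ([1+k]*[1+n]C[1+k]≡[1+n]*nCk n zero)
[1+n]*[1+n]Ck≡k*[1+n]Ck+[1+k]*[1+n]C[1+k] n (suc k) = ≡.sym (begin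
  suc k ℕ.* (suc n C suc k) ℕ.+ suc (suc k) ℕ.* (suc n C suc (suc k))
    ≡⟨ ≡.cong₂ ℕ._+_ ([1+k]*[1+n]C[1+k]≡[1+n]*nCk n k) ([1+k]*[1+n]C[1+k]≡[1+n]*nCk n (suc k)) ⟩
  suc n ℕ.* (n C k) ℕ.+ suc n ℕ.* (n C suc k)
    ≡⟨ ≡.sym (ℕₚ.*-distribˡ-+ (suc n) (n C k) (n C suc k)) ⟩
  suc n ℕ.* (n C k ℕ.+ n C suc k)
    ≡⟨ ≡.cong (suc n ℕ.*_) (nCk+nC[k+1]≡[n+1]C[k+1] n k) ⟩
  suc n ℕ.* (suc n C suc k)
    ∎)
  where open ≡.≡-Reasoning

module Matrices {c ℓ} (R : CommutativeRing c ℓ) where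
  open CommutativeRing R hiding (zero)
  open FiniteSum commutativeSemiring
  open import Algebra.Properties.Semiring.Exp semiring using (_^_)
  open import Algebra.Properties.Semiring.Mult semiring using (×-homo-+; ×1-homo-*) renaming (_×_ to _·_)
  open import Algebra.Solver.Ring.NaturalCoefficients.Default commutativeSemiring
  open import Relation.Binary.Reasoning.Setoid setoid

  Matrix : Set c
  Matrix = ℕ → ℕ → Carrier

  infix  4 _≈ᴹ_
  infixl 7 _⋆_

  _≈ᴹ_ : Matrix → Matrix → Set ℓ
  M ≈ᴹ N = ∀ n k → M n k ≈ N n k

  _⋆_ : Matrix → Matrix → Matrix
  (M ⋆ N) n k = sum n (λ j → M n j * N j k)

  I : Matrix
  I n k with n ≟ k
  ... | yes _ = 1#
  ... | no  _ = 0#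

  LowerTriangular : Matrix → Set ℓ
  LowerTriangular M = ∀ n k → n < k → M n k ≈ 0#

  LowerBidiagonal : Matrix → Set ℓ
  LowerBidiagonal M = LowerTriangular M × (∀ n k → suc k < n → M n k ≈ 0#)

  ν : ℕ → Carrier
  ν n = n · 1#

  L : Carrier → Carrier → Carrier → Matrix
  L x y z n k with n ≟ k | n ≟ suc k
  ... | yes _ | _     = ν n * x + y
  ... | no  _ | yes _ = ν n * z
  ... | no  _ | no  _ = 0#

  B : Carrier → Matrix
  B q n k = ν (n C k) * q ^ (n ∸ k)

  ⋆-cong : ∀ {M M′ N N′} → M ≈ᴹ M′ → N ≈ᴹ N′ → M ⋆ N ≈ᴹ M′ ⋆ N′
  ⋆-cong M≈M′ N≈N′ n k = sum-cong n (λ j → *-cong (M≈M′ n j) (N≈N′ j k))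

  ⋆-identityˡ : ∀ M → I ⋆ M ≈ᴹ M
  ⋆-identityˡ M n k = begin
    sum n (λ j → I n j * M j k)  ≈⟨ sum-single n n ≤-refl (λ j _ j≢n → trans (*-congʳ (I-off (j≢n ∘ ≡.sym))) (zeroˡ _)) ⟩
    I n n * M n k                ≈⟨ *-congʳ I-diagonal ⟩
    1# * M n k                   ≈⟨ *-identityˡ (M n k) ⟩
    M n k                        ∎
    where
    I-diagonal : I n n ≈ 1#
    I-diagonal with n ≟ n
    ... | yes _   = refl
    ... | no  n≢n = ⊥-elim (n≢n ≡.refl)

    I-off : ∀ {j} → n ≢ j → I n j ≈ 0#
    I-off {j} n≢j with n ≟ j
    ... | yes n≡j = ⊥-elim (n≢j n≡j)
    ... | no  _   = refl

  ⋆-lowerTriangular : ∀ {M N} → LowerTriangular N → LowerTriangular (M ⋆ N)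
  ⋆-lowerTriangular N-lower n k n<k =
    sum-zero n (λ j j≤n → trans (*-congˡ (N-lower j k (ℕₚ.≤-<-trans j≤n n<k))) (zeroʳ _))

  ⋆-diagonal : ∀ {M N} → LowerTriangular N → ∀ n → (M ⋆ N) n n ≈ M n n * N n n
  ⋆-diagonal N-lower n =
    sum-single n n ≤-refl (λ j j≤n j≢n → trans (*-congˡ (N-lower j n (≤∧≢⇒< j≤n j≢n))) (zeroʳ _))

  ⋆-assoc : ∀ {M N Q} → LowerTriangular N → M ⋆ (N ⋆ Q) ≈ᴹ (M ⋆ N) ⋆ Q
  ⋆-assoc {M} {N} {Q} N-lower n k = begin
    sum n (λ j → M n j * sum j (λ i → N j i * Q i k))
      ≈⟨ sum-cong-≤ n (λ j j≤n → *-congˡ (sym (sum-truncate j n j≤n λ i j<i →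
           trans (*-congʳ (N-lower j i j<i)) (zeroˡ _)))) ⟩
    sum n (λ j → M n j * sum n (λ i → N j i * Q i k))
      ≈⟨ sum-cong n (λ j → *-distribˡ-sum n (M n j) _) ⟩
    sum n (λ j → sum n (λ i → M n j * (N j i * Q i k)))
      ≈⟨ sum-comm n n _ ⟩
    sum n (λ i → sum n (λ j → M n j * (N j i * Q i k)))
      ≈⟨ sum-cong n (λ i → trans (sum-cong n (λ j → sym (*-assoc _ _ _))) (sym (*-distribʳ-sum n (Q i k) _))) ⟩
    sum n (λ i → sum n (λ j → M n j * N j i) * Q i k)
      ∎

  ⋆-lowerBidiagonalˡ : ∀ {M N} → LowerBidiagonal M → ∀ m k →
    (M ⋆ N) (suc m) k ≈ M (suc m) m * N m k + M (suc m) (suc m) * N (suc m) k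
  ⋆-lowerBidiagonalˡ (_ , M-band) m k = sum-pair (suc m) m ≤-refl λ j j≤1+m j≢m j≢1+m →
    trans (*-congʳ (M-band (suc m) j (s≤s (≤∧≢⇒< (s≤s⁻¹ (≤∧≢⇒< j≤1+m j≢1+m)) j≢m)))) (zeroˡ _)

  ⋆-lowerBidiagonalʳ : ∀ {M N} → LowerBidiagonal N → ∀ m k → k ≤ m →
    (M ⋆ N) (suc m) k ≈ M (suc m) k * N k k + M (suc m) (suc k) * N (suc k) k
  ⋆-lowerBidiagonalʳ {M} {N} (N-lower , N-band) m k k≤m =
    sum-pair (suc m) k (s≤s k≤m) (λ j _ j≢k j≢1+k → trans (*-congˡ (outside-band j≢k j≢1+k)) (zeroʳ _))
    where
    outside-band : ∀ {j} → j ≢ k → j ≢ suc k → N j k ≈ 0#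
    outside-band {j} j≢k j≢1+k with <-cmp j k
    ... | tri< j<k _ _ = N-lower j k j<k
    ... | tri≈ _ j≡k _ = ⊥-elim (j≢k j≡k)
    ... | tri> _ _ k<j = N-band j k (≤∧≢⇒< k<j (j≢1+k ∘ ≡.sym))

  L-diagonal : ∀ x y z n → L x y z n n ≈ ν n * x + y
  L-diagonal x y z n with n ≟ n
  ... | yes _   = refl
  ... | no  n≢n = ⊥-elim (n≢n ≡.refl)

  L-subdiagonal : ∀ x y z k → L x y z (suc k) k ≈ ν (suc k) * z
  L-subdiagonal x y z k with suc k ≟ k | suc k ≟ suc k
  ... | yes 1+k≡k | _           = ⊥-elim (<⇒≢ (ℕₚ.n<1+n k) (≡.sym 1+k≡k))
  ... | no  _     | yes _       = refl
  ... | no  _     | no  1+k≢1+k = ⊥-elim (1+k≢1+k ≡.refl)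

  L-lowerBidiagonal : ∀ x y z → LowerBidiagonal (L x y z)
  L-lowerBidiagonal x y z =
      (λ n k n<k → outside-band (<⇒≢ n<k) (<⇒≢ (m≤n⇒m≤1+n n<k)))
    , (λ n k 1+k<n → outside-band (<⇒≢ (ℕₚ.<-trans (ℕₚ.n<1+n k) 1+k<n) ∘ ≡.sym) (<⇒≢ 1+k<n ∘ ≡.sym))
    where
    outside-band : ∀ {n k} → n ≢ k → n ≢ suc k → L x y z n k ≈ 0#
    outside-band {n} {k} n≢k n≢1+k with n ≟ k | n ≟ suc k
    ... | yes n≡k | _         = ⊥-elim (n≢k n≡k)
    ... | no  _   | yes n≡1+k = ⊥-elim (n≢1+k n≡1+k)
    ... | no  _   | no  _     = refl

  B-lowerTriangular : ∀ q → LowerTriangular (B q)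
  B-lowerTriangular q n k n<k = trans (*-congʳ (reflexive (≡.cong ν (k>n⇒nCk≡0 n<k)))) (zeroˡ _)

  -- Entry (m+1, k) of L(a,b,c) B_q and of B_q L(a,b,qa+c), with N = m+1, K = k, K′ = k+1,
  -- C₀ = C(m,k), C₁ = C(m+1,k), C₂ = C(m+1,k+1) and Q = q^(m-k).
  bidiagonal-intertwining-identity : ∀ {N K K′ C₀ C₁ C₂} a b c q Q →
    N * C₀ ≈ K′ * C₂ → N * C₁ ≈ K * C₁ + K′ * C₂ →
    (N * c) * (C₀ * Q) + (N * a + b) * (C₁ * (q * Q)) ≈ (C₁ * (q * Q)) * (K * a + b) + (C₂ * Q) * (K′ * (q * a + c))
  bidiagonal-intertwining-identity {N} {K} {K′} {C₀} {C₁} {C₂} a b c q Q NC₀≈K′C₂ NC₁≈KC₁+K′C₂ = begin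
    (N * c) * (C₀ * Q) + (N * a + b) * (C₁ * (q * Q))
      ≈⟨ solve 8 (λ N C₀ C₁ a b c q Q →
           (N :* c) :* (C₀ :* Q) :+ (N :* a :+ b) :* (C₁ :* (q :* Q)) :=
           (N :* C₀) :* (c :* Q) :+ (N :* C₁) :* (a :* (q :* Q)) :+ b :* (C₁ :* (q :* Q))) refl N C₀ C₁ a b c q Q ⟩
    (N * C₀) * (c * Q) + (N * C₁) * (a * (q * Q)) + b * (C₁ * (q * Q))
      ≈⟨ +-congʳ (+-cong (*-congʳ NC₀≈K′C₂) (*-congʳ NC₁≈KC₁+K′C₂)) ⟩
    (K′ * C₂) * (c * Q) + (K * C₁ + K′ * C₂) * (a * (q * Q)) + b * (C₁ * (q * Q))
      ≈⟨ solve 9 (λ K K′ C₁ C₂ a b c q Q →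
           (K′ :* C₂) :* (c :* Q) :+ (K :* C₁ :+ K′ :* C₂) :* (a :* (q :* Q)) :+ b :* (C₁ :* (q :* Q)) :=
           (C₁ :* (q :* Q)) :* (K :* a :+ b) :+ (C₂ :* Q) :* (K′ :* (q :* a :+ c))) refl K K′ C₁ C₂ a b c q Q ⟩
    (C₁ * (q * Q)) * (K * a + b) + (C₂ * Q) * (K′ * (q * a + c))
      ∎

  L⋆B≈B⋆L-belowDiagonal : ∀ a b c q m k → k ≤ m → (L a b c ⋆ B q) (suc m) k ≈ (B q ⋆ L a b (q * a + c)) (suc m) k
  L⋆B≈B⋆L-belowDiagonal a b c q m k k≤m = begin
    (L a b c ⋆ B q) (suc m) k
      ≈⟨ ⋆-lowerBidiagonalˡ {N = B q} (L-lowerBidiagonal a b c) m k ⟩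
    L a b c (suc m) m * B q m k + L a b c (suc m) (suc m) * B q (suc m) k
      ≈⟨ +-cong (*-congʳ (L-subdiagonal a b c m)) (*-cong (L-diagonal a b c (suc m)) (*-congˡ q^[1+m∸k])) ⟩
    (ν (suc m) * c) * (ν (m C k) * Q) + (ν (suc m) * a + b) * (ν (suc m C k) * (q * Q))
      ≈⟨ bidiagonal-intertwining-identity a b c q Q absorption weighted-pascal ⟩
    (ν (suc m C k) * (q * Q)) * (ν k * a + b) + (ν (suc m C suc k) * Q) * (ν (suc k) * (q * a + c))
      ≈⟨ +-cong (*-cong (*-congˡ q^[1+m∸k]) (L-diagonal a b (q * a + c) k)) (*-congˡ (L-subdiagonal a b (q * a + c) k)) ⟨
    B q (suc m) k * L a b (q * a + c) k k + B q (suc m) (suc k) * L a b (q * a + c) (suc k) k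
      ≈⟨ ⋆-lowerBidiagonalʳ {B q} (L-lowerBidiagonal a b (q * a + c)) m k k≤m ⟨
    (B q ⋆ L a b (q * a + c)) (suc m) k
      ∎
    where
    Q : Carrier
    Q = q ^ (m ∸ k)

    q^[1+m∸k] : q ^ (suc m ∸ k) ≈ q * Q
    q^[1+m∸k] = reflexive (≡.cong (q ^_) (+-∸-assoc 1 k≤m))

    absorption : ν (suc m) * ν (m C k) ≈ ν (suc k) * ν (suc m C suc k)
    absorption = begin
      ν (suc m) * ν (m C k)             ≈⟨ ×1-homo-* (suc m) (m C k) ⟨
      ν (suc m ℕ.* (m C k))             ≡⟨ ≡.cong ν ([1+k]*[1+n]C[1+k]≡[1+n]*nCk m k) ⟨
      ν (suc k ℕ.* (suc m C suc k))     ≈⟨ ×1-homo-* (suc k) (suc m C suc k) ⟩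
      ν (suc k) * ν (suc m C suc k)     ∎

    weighted-pascal : ν (suc m) * ν (suc m C k) ≈ ν k * ν (suc m C k) + ν (suc k) * ν (suc m C suc k)
    weighted-pascal = begin
      ν (suc m) * ν (suc m C k)
        ≈⟨ ×1-homo-* (suc m) (suc m C k) ⟨
      ν (suc m ℕ.* (suc m C k))
        ≡⟨ ≡.cong ν ([1+n]*[1+n]Ck≡k*[1+n]Ck+[1+k]*[1+n]C[1+k] m k) ⟩
      ν (k ℕ.* (suc m C k) ℕ.+ suc k ℕ.* (suc m C suc k))
        ≈⟨ ×-homo-+ 1# (k ℕ.* (suc m C k)) (suc k ℕ.* (suc m C suc k)) ⟩
      ν (k ℕ.* (suc m C k)) + ν (suc k ℕ.* (suc m C suc k))
        ≈⟨ +-cong (×1-homo-* k (suc m C k)) (×1-homo-* (suc k) (suc m C suc k)) ⟩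
      ν k * ν (suc m C k) + ν (suc k) * ν (suc m C suc k)
        ∎

  L⋆B≈B⋆L : ∀ a b c q → L a b c ⋆ B q ≈ᴹ B q ⋆ L a b (q * a + c)
  L⋆B≈B⋆L a b c q n k with <-cmp k n
  ... | tri> _ _ n<k = trans (⋆-lowerTriangular {L a b c} (B-lowerTriangular q) n k n<k)
                             (sym (⋆-lowerTriangular {B q} (proj₁ (L-lowerBidiagonal a b (q * a + c))) n k n<k))
  ... | tri≈ _ ≡.refl _ = begin
    (L a b c ⋆ B q) n n                ≈⟨ ⋆-diagonal {L a b c} (B-lowerTriangular q) n ⟩
    L a b c n n * B q n n              ≈⟨ *-comm _ _ ⟩
    B q n n * L a b c n n              ≈⟨ *-congˡ (trans (L-diagonal a b c n) (sym (L-diagonal a b (q * a + c) n))) ⟩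
    B q n n * L a b (q * a + c) n n    ≈⟨ ⋆-diagonal {B q} (proj₁ (L-lowerBidiagonal a b (q * a + c))) n ⟨
    (B q ⋆ L a b (q * a + c)) n n      ∎
  L⋆B≈B⋆L a b c q (suc m) k | tri< k<1+m _ _ = L⋆B≈B⋆L-belowDiagonal a b c q m k (s≤s⁻¹ k<1+m)

  conjugate-L-by-B : ∀ {Binv} a b c q → Binv ⋆ B q ≈ᴹ I → Binv ⋆ (L a b c ⋆ B q) ≈ᴹ L a b (q * a + c)
  conjugate-L-by-B {Binv} a b c q Binv⋆B≈I n k = begin
    (Binv ⋆ (L a b c ⋆ B q)) n k  ≈⟨ ⋆-cong {Binv} (λ _ _ → refl) (L⋆B≈B⋆L a b c q) n k ⟩
    (Binv ⋆ (B q ⋆ L′)) n k       ≈⟨ ⋆-assoc {Binv} {B q} {L′} (B-lowerTriangular q) n k ⟩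
    ((Binv ⋆ B q) ⋆ L′) n k       ≈⟨ ⋆-cong {Binv ⋆ B q} {I} {L′} Binv⋆B≈I (λ _ _ → refl) n k ⟩
    (I ⋆ L′) n k                  ≈⟨ ⋆-identityˡ L′ n k ⟩
    L′ n k                        ∎
    where
    L′ : Matrix
    L′ = L a b (q * a + c)

open import Defs

-- Ser is ℤ[[q]][[c]][[b]][[a]], a series in a whose coefficients are series in b, and so on;
-- the product _*S_ agrees with the iterated Cauchy product, so Ser inherits its ring laws.
module ℤ[[q]] = PowerSeries ℤₚ.+-*-commutativeRing
module ℤ[[q]][[c]] = PowerSeries ℤ[[q]].commutativeRing
module ℤ[[q]][[c]][[b]] = PowerSeries ℤ[[q]][[c]].commutativeRing
module ℤ[[q]][[c]][[b]][[a]] = PowerSeries ℤ[[q]][[c]][[b]].commutativeRing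

sumℤ-cong : ∀ n {h g : ℕ → ℤ} → (∀ i → h i ≡ g i) → sumℤ n h ≡ sumℤ n g
sumℤ-cong zero    h≡g = h≡g 0
sumℤ-cong (suc n) h≡g = ≡.cong₂ ℤ._+_ (sumℤ-cong n h≡g) (h≡g (suc n))

sumℤ-ℤ : ∀ n h → FiniteSum.sum (CommutativeRing.commutativeSemiring ℤₚ.+-*-commutativeRing) n h ≡ sumℤ n h
sumℤ-ℤ zero    h = ≡.refl
sumℤ-ℤ (suc n) h = ≡.cong (ℤ._+ h (suc n)) (sumℤ-ℤ n h)

sumℤ-ℤ[[q]] : ∀ n h l →
  FiniteSum.sum (CommutativeRing.commutativeSemiring ℤ[[q]].commutativeRing) n h l ≡ sumℤ n (λ x → h x l)
sumℤ-ℤ[[q]] n h l = ≡.trans (ℤ[[q]].sum-apply n h l) (sumℤ-ℤ n _)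

sumℤ-ℤ[[q]][[c]] : ∀ n h k l →
  FiniteSum.sum (CommutativeRing.commutativeSemiring ℤ[[q]][[c]].commutativeRing) n h k l ≡ sumℤ n (λ x → h x k l)
sumℤ-ℤ[[q]][[c]] n h k l = ≡.trans (≡.cong-app (ℤ[[q]][[c]].sum-apply n h k) l) (sumℤ-ℤ[[q]] n (λ x → h x k) l)

sumℤ-ℤ[[q]][[c]][[b]] : ∀ n h j k l →
  FiniteSum.sum (CommutativeRing.commutativeSemiring ℤ[[q]][[c]][[b]].commutativeRing) n h j k l ≡ sumℤ n (λ x → h x j k l)
sumℤ-ℤ[[q]][[c]][[b]] n h j k l =
  ≡.trans (≡.cong (λ t → t k l) (ℤ[[q]][[c]][[b]].sum-apply n h j)) (sumℤ-ℤ[[q]][[c]] n (λ x → h x j) k l)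

*-ℤ[[q]] : ∀ f g l → (f ℤ[[q]].*ₛ g) l ≡ sumℤ l (λ l₁ → f l₁ ℤ.* g (l ∸ l₁))
*-ℤ[[q]] f g l = sumℤ-ℤ l _

*-ℤ[[q]][[c]] : ∀ f g k l →
  (f ℤ[[q]][[c]].*ₛ g) k l ≡ sumℤ k (λ k₁ → sumℤ l (λ l₁ → f k₁ l₁ ℤ.* g (k ∸ k₁) (l ∸ l₁)))
*-ℤ[[q]][[c]] f g k l = ≡.trans (sumℤ-ℤ[[q]] k _ l) (sumℤ-cong k (λ k₁ → *-ℤ[[q]] (f k₁) (g (k ∸ k₁)) l))

*-ℤ[[q]][[c]][[b]] : ∀ f g j k l → (f ℤ[[q]][[c]][[b]].*ₛ g) j k l ≡
  sumℤ j (λ j₁ → sumℤ k (λ k₁ → sumℤ l (λ l₁ → f j₁ k₁ l₁ ℤ.* g (j ∸ j₁) (k ∸ k₁) (l ∸ l₁))))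
*-ℤ[[q]][[c]][[b]] f g j k l =
  ≡.trans (sumℤ-ℤ[[q]][[c]] j _ k l) (sumℤ-cong j (λ j₁ → *-ℤ[[q]][[c]] (f j₁) (g (j ∸ j₁)) k l))

*S-ℤ[[q]][[c]][[b]][[a]] : ∀ f g → (f *S g) ≈S (f ℤ[[q]][[c]][[b]][[a]].*ₛ g)
*S-ℤ[[q]][[c]][[b]][[a]] f g i j k l = ≡.sym
  (≡.trans (sumℤ-ℤ[[q]][[c]][[b]] i _ j k l) (sumℤ-cong i (λ i₁ → *-ℤ[[q]][[c]][[b]] (f i₁) (g (i ∸ i₁)) j k l)))

1S-ℤ[[q]][[c]][[b]][[a]] : 1S ≈S ℤ[[q]][[c]][[b]][[a]].1ₛ
1S-ℤ[[q]][[c]][[b]][[a]] zero    zero    zero    zero    = ≡.refl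
1S-ℤ[[q]][[c]][[b]][[a]] zero    zero    zero    (suc l) = ≡.refl
1S-ℤ[[q]][[c]][[b]][[a]] zero    zero    (suc k) l       = ≡.refl
1S-ℤ[[q]][[c]][[b]][[a]] zero    (suc j) k       l       = ≡.refl
1S-ℤ[[q]][[c]][[b]][[a]] (suc i) j       k       l       = ≡.refl

serRing : CommutativeRing 0ℓ 0ℓ
serRing = record
  { isCommutativeRing = isCommutativeRing-replace-* ℤ[[q]][[c]][[b]][[a]].commutativeRing
                          _*S_ 1S *S-ℤ[[q]][[c]][[b]][[a]] 1S-ℤ[[q]][[c]][[b]][[a]] }

open CommutativeRing serRing using (_≈_; _*_; _+_; 0#; 1#; refl; sym; trans; +-cong; *-cong; zeroˡ; zeroʳ)
open import Algebra.Properties.Semiring.Exp (CommutativeRing.semiring serRing) using (_^_)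
open import Relation.Binary.Reasoning.Setoid (CommutativeRing.setoid serRing)
open Matrices serRing
  using (ν; I; L; B; LowerBidiagonal; L-lowerBidiagonal; conjugate-L-by-B)
  renaming (_⋆_ to _⋆ᴹ_; ⋆-cong to ⋆ᴹ-cong)

constS-0 : constS (+ 0) ≈ 0#
constS-0 zero    zero    zero    zero    = ≡.refl
constS-0 zero    zero    zero    (suc l) = ≡.refl
constS-0 zero    zero    (suc k) l       = ≡.refl
constS-0 zero    (suc j) k       l       = ≡.refl
constS-0 (suc i) j       k       l       = ≡.refl

constS-suc : ∀ n → constS (+ suc n) ≈ 1# + constS (+ n)
constS-suc n zero    zero    zero    zero    = ≡.refl
constS-suc n zero    zero    zero    (suc l) = ≡.refl
constS-suc n zero    zero    (suc k) l       = ≡.refl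
constS-suc n zero    (suc j) k       l       = ≡.refl
constS-suc n (suc i) j       k       l       = ≡.refl

constS≈ν : ∀ n → constS (+ n) ≈ ν n
constS≈ν zero    = constS-0
constS≈ν (suc n) = trans (constS-suc n) (+-cong {1#} refl (constS≈ν n))

^S≈^ : ∀ x n → x ^S n ≈ x ^ n
^S≈^ x zero    = refl
^S≈^ x (suc n) = *-cong {x} refl (^S≈^ x n)

⋆≈⋆ᴹ : ∀ M N → (M ⋆ N) ≈M (M ⋆ᴹ N)
⋆≈⋆ᴹ M N n k = sumS≈sum n (λ j → M n j * N j k)
  where
  sumS≈sum : ∀ n h → sumS n h ≈ FiniteSum.sum (CommutativeRing.commutativeSemiring serRing) n h
  sumS≈sum zero    h i j k l = ≡.refl
  sumS≈sum (suc n) h i j k l = ≡.cong (ℤ._+ h (suc n) i j k l) (sumS≈sum n h i j k l)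

IdMat≈I : IdMat ≈M I
IdMat≈I n k with n ≟ k
... | yes _ = refl
... | no  _ = refl

Lbidiag≈L : ∀ x y z → Lbidiag x y z ≈M L x y z
Lbidiag≈L x y z n k with n ≟ k | n ≟ suc k
... | yes _ | _     = +-cong {n ·S x} {ν n * x} {y} (*-cong {constS (+ n)} {ν n} {x} (constS≈ν n) refl) refl
... | no  _ | yes _ = *-cong {constS (+ n)} {ν n} {z} (constS≈ν n) refl
... | no  _ | no  _ = refl

Bq≈B : Bq ≈M B varQ
Bq≈B n k = *-cong {constS (+ (n C k))} {ν (n C k)} (constS≈ν (n C k)) (^S≈^ varQ (n ∸ k))

conjugate-Lbidiag-by-Bq : ∀ Binv → (Binv ⋆ Bq) ≈M IdMat →
  (Binv ⋆ (Lbidiag varA varB varC ⋆ Bq)) ≈M Lbidiag varA varB (varQ *S varA +S varC)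
conjugate-Lbidiag-by-Bq Binv Binv⋆Bq≈Id n k = begin
  (Binv ⋆ (L₁ ⋆ Bq)) n k                ≈⟨ ⋆≈⋆ᴹ Binv (L₁ ⋆ Bq) n k ⟩
  (Binv ⋆ᴹ (L₁ ⋆ Bq)) n k               ≈⟨ ⋆ᴹ-cong {Binv} {Binv} {L₁ ⋆ Bq} (λ _ _ → refl) L₁⋆Bq≈L⋆B n k ⟩
  (Binv ⋆ᴹ (L varA varB varC ⋆ᴹ B varQ)) n k  ≈⟨ conjugate-L-by-B {Binv} varA varB varC varQ Binv⋆B≈I n k ⟩
  L varA varB (varQ * varA + varC) n k        ≈⟨ Lbidiag≈L varA varB (varQ * varA + varC) n k ⟨
  Lbidiag varA varB (varQ * varA + varC) n k  ∎
  where
  L₁ : Mat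
  L₁ = Lbidiag varA varB varC

  L₁⋆Bq≈L⋆B : (L₁ ⋆ Bq) ≈M (L varA varB varC ⋆ᴹ B varQ)
  L₁⋆Bq≈L⋆B n k = trans (⋆≈⋆ᴹ L₁ Bq n k) (⋆ᴹ-cong {L₁} {L varA varB varC} {Bq} (Lbidiag≈L varA varB varC) Bq≈B n k)

  Binv⋆B≈I : (Binv ⋆ᴹ B varQ) ≈M I
  Binv⋆B≈I n k = begin
    (Binv ⋆ᴹ B varQ) n k  ≈⟨ ⋆ᴹ-cong {Binv} {Binv} {B varQ} (λ _ _ → refl) (λ n k → sym (Bq≈B n k)) n k ⟩
    (Binv ⋆ᴹ Bq) n k      ≈⟨ ⋆≈⋆ᴹ Binv Bq n k ⟨
    (Binv ⋆ Bq) n k       ≈⟨ Binv⋆Bq≈Id n k ⟩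
    IdMat n k             ≈⟨ IdMat≈I n k ⟩
    I n k                 ∎

nonNeg-resp : ∀ {f g} → f ≈ g → NonNegCoeffs f → NonNegCoeffs g
nonNeg-resp f≈g f≥0 i j k l = ≡.subst (+ 0 ℤ.≤_) (f≈g i j k l) (f≥0 i j k l)

0S-nonNeg : NonNegCoeffs 0S
0S-nonNeg _ _ _ _ = ℤ.+≤+ z≤n

1S-nonNeg : NonNegCoeffs 1S
1S-nonNeg zero    zero    zero    zero    = ℤ.+≤+ z≤n
1S-nonNeg zero    zero    zero    (suc l) = ℤ.+≤+ z≤n
1S-nonNeg zero    zero    (suc k) l       = ℤ.+≤+ z≤n
1S-nonNeg zero    (suc j) k       l       = ℤ.+≤+ z≤n
1S-nonNeg (suc i) j       k       l       = ℤ.+≤+ z≤n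

varA-nonNeg : NonNegCoeffs varA
varA-nonNeg (suc zero)    zero    zero    zero    = ℤ.+≤+ z≤n
varA-nonNeg (suc zero)    zero    zero    (suc l) = ℤ.+≤+ z≤n
varA-nonNeg (suc zero)    zero    (suc k) l       = ℤ.+≤+ z≤n
varA-nonNeg (suc zero)    (suc j) k       l       = ℤ.+≤+ z≤n
varA-nonNeg (suc (suc i)) j       k       l       = ℤ.+≤+ z≤n
varA-nonNeg zero          j       k       l       = ℤ.+≤+ z≤n

varB-nonNeg : NonNegCoeffs varB
varB-nonNeg zero    (suc zero)    zero    zero    = ℤ.+≤+ z≤n
varB-nonNeg zero    (suc zero)    zero    (suc l) = ℤ.+≤+ z≤n
varB-nonNeg zero    (suc zero)    (suc k) l       = ℤ.+≤+ z≤n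
varB-nonNeg zero    (suc (suc j)) k       l       = ℤ.+≤+ z≤n
varB-nonNeg zero    zero          k       l       = ℤ.+≤+ z≤n
varB-nonNeg (suc i) j             k       l       = ℤ.+≤+ z≤n

varC-nonNeg : NonNegCoeffs varC
varC-nonNeg zero    zero    (suc zero)    zero    = ℤ.+≤+ z≤n
varC-nonNeg zero    zero    (suc zero)    (suc l) = ℤ.+≤+ z≤n
varC-nonNeg zero    zero    (suc (suc k)) l       = ℤ.+≤+ z≤n
varC-nonNeg zero    zero    zero          l       = ℤ.+≤+ z≤n
varC-nonNeg zero    (suc j) k             l       = ℤ.+≤+ z≤n
varC-nonNeg (suc i) j       k             l       = ℤ.+≤+ z≤n

varQ-nonNeg : NonNegCoeffs varQ
varQ-nonNeg zero    zero    zero    (suc zero)    = ℤ.+≤+ z≤n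
varQ-nonNeg zero    zero    zero    (suc (suc l)) = ℤ.+≤+ z≤n
varQ-nonNeg zero    zero    zero    zero          = ℤ.+≤+ z≤n
varQ-nonNeg zero    zero    (suc k) l             = ℤ.+≤+ z≤n
varQ-nonNeg zero    (suc j) k       l             = ℤ.+≤+ z≤n
varQ-nonNeg (suc i) j       k       l             = ℤ.+≤+ z≤n

+S-nonNeg : ∀ {f g} → NonNegCoeffs f → NonNegCoeffs g → NonNegCoeffs (f +S g)
+S-nonNeg f≥0 g≥0 i j k l = ℤₚ.+-mono-≤ (f≥0 i j k l) (g≥0 i j k l)

*S-nonNeg : ∀ {f g} → NonNegCoeffs f → NonNegCoeffs g → NonNegCoeffs (f *S g)
*S-nonNeg f≥0 g≥0 i j k l =
  sumℤ-nonNeg i λ _ → sumℤ-nonNeg j λ _ → sumℤ-nonNeg k λ _ → sumℤ-nonNeg l λ _ → *-nonNeg (f≥0 _ _ _ _) (g≥0 _ _ _ _)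
  where
  sumℤ-nonNeg : ∀ n {h : ℕ → ℤ} → (∀ i → + 0 ℤ.≤ h i) → + 0 ℤ.≤ sumℤ n h
  sumℤ-nonNeg zero    h≥0 = h≥0 0
  sumℤ-nonNeg (suc n) h≥0 = ℤₚ.+-mono-≤ (sumℤ-nonNeg n h≥0) (h≥0 (suc n))

  *-nonNeg : ∀ {x y} → + 0 ℤ.≤ x → + 0 ℤ.≤ y → + 0 ℤ.≤ x ℤ.* y
  *-nonNeg {y = y} x≥0 y≥0 = ℤₚ.*-monoʳ-≤-nonNeg y {{ℤ.nonNegative y≥0}} x≥0

ν-nonNeg : ∀ n → NonNegCoeffs (ν n)
ν-nonNeg zero    = 0S-nonNeg
ν-nonNeg (suc n) = +S-nonNeg 1S-nonNeg (ν-nonNeg n)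

L-nonNeg : ∀ {x y z} → NonNegCoeffs x → NonNegCoeffs y → NonNegCoeffs z → ∀ n k → NonNegCoeffs (L x y z n k)
L-nonNeg x≥0 y≥0 z≥0 n k with n ≟ k | n ≟ suc k
... | yes _ | _     = +S-nonNeg (*S-nonNeg (ν-nonNeg n) x≥0) y≥0
... | no  _ | yes _ = *S-nonNeg (ν-nonNeg n) z≥0
... | no  _ | no  _ = 0S-nonNeg

sumFin-cong : ∀ {m} {h g : Fin m → Ser} → (∀ j → h j ≈ g j) → sumFin h ≈ sumFin g
sumFin-cong {zero}  h≈g = refl
sumFin-cong {suc m} h≈g i j k l = ≡.cong₂ ℤ._+_ (h≈g F.zero i j k l) (sumFin-cong {m} (h≈g ∘ F.suc) i j k l)

sumFin-zero : ∀ {m} {h : Fin m → Ser} → (∀ j → h j ≈ 0#) → sumFin h ≈ 0#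
sumFin-zero {zero}  h≈0 = refl
sumFin-zero {suc m} h≈0 i j k l = ≡.cong₂ ℤ._+_ (h≈0 F.zero i j k l) (sumFin-zero {m} (h≈0 ∘ F.suc) i j k l)

sumFin-nonNeg : ∀ {m} {h : Fin m → Ser} → (∀ j → NonNegCoeffs (h j)) → NonNegCoeffs (sumFin h)
sumFin-nonNeg {zero}  h≥0 = 0S-nonNeg
sumFin-nonNeg {suc m} h≥0 = +S-nonNeg (h≥0 F.zero) (sumFin-nonNeg (h≥0 ∘ F.suc))

x≈0⇒s*x*d≈0 : ∀ s x d → x ≈ 0# → s * x * d ≈ 0#
x≈0⇒s*x*d≈0 s x d x≈0 = trans (*-cong {s * x} {0#} {d} (trans (*-cong {s} refl x≈0) (zeroʳ s)) refl) (zeroˡ d)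

d≈0⇒s*x*d≈0 : ∀ s x d → d ≈ 0# → s * x * d ≈ 0#
d≈0⇒s*x*d≈0 s x d d≈0 = trans (*-cong {s * x} refl d≈0) (zeroʳ (s * x))

det-cong : ∀ m {M N : Fin m → Fin m → Ser} → (∀ i j → M i j ≈ N i j) → det m M ≈ det m N
det-cong zero    M≈N = refl
det-cong (suc m) {M} {N} M≈N = sumFin-cong λ j →
  *-cong {signS (toℕ j) * M F.zero j} (*-cong {signS (toℕ j)} refl (M≈N F.zero j))
         (det-cong m (λ r s → M≈N (F.suc r) (punchIn j s)))

det-zeroColumn : ∀ m (M : Fin (suc m) → Fin (suc m) → Ser) → (∀ i → M i F.zero ≈ 0#) → det (suc m) M ≈ 0#

det-zeroColumn-punchIn : ∀ m (M : Fin m → Fin (suc m) → Ser) (j : Fin m) → (∀ i → M i F.zero ≈ 0#) →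
  det m (λ i s → M i (punchIn (F.suc j) s)) ≈ 0#

det-zeroColumn m M column≈0 = sumFin-zero laplaceTerm≈0
  where
  cofactor : Fin (suc m) → Ser
  cofactor j = det m (λ r s → M (F.suc r) (punchIn j s))

  laplaceTerm≈0 : ∀ j → signS (toℕ j) * M F.zero j * cofactor j ≈ 0#
  laplaceTerm≈0 F.zero    = x≈0⇒s*x*d≈0 1S (M F.zero F.zero) (cofactor F.zero) (column≈0 F.zero)
  laplaceTerm≈0 (F.suc j) = d≈0⇒s*x*d≈0 (signS (toℕ (F.suc j))) (M F.zero (F.suc j)) (cofactor (F.suc j))
    (det-zeroColumn-punchIn m (M ∘ F.suc) j (column≈0 ∘ F.suc))

det-zeroColumn-punchIn (suc m) M j column≈0 = det-zeroColumn m (λ i s → M i (punchIn (F.suc j) s)) column≈0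

coeffwiseTP-resp : ∀ {M N} → M ≈M N → CoeffwiseTP N → CoeffwiseTP M
coeffwiseTP-resp M≈N N-TP m r c r↑ c↑ = nonNeg-resp (sym (det-cong m (λ i j → M≈N (r i) (c j)))) (N-TP m r c r↑ c↑)

lowerBidiagonal⇒coeffwiseTP : ∀ M → LowerBidiagonal M → (∀ n k → NonNegCoeffs (M n k)) → CoeffwiseTP M
lowerBidiagonal⇒coeffwiseTP M (M-lower , M-band) M≥0 = minor-nonNeg
  where
  minor-nonNeg : CoeffwiseTP M
  minor-nonNeg zero    r c r↑ c↑ = 1S-nonNeg
  minor-nonNeg (suc m) r c r↑ c↑ = sumFin-nonNeg laplaceTerm-nonNeg
    where
    cofactor : Fin (suc m) → Ser
    cofactor j = det m (λ i s → M (r (F.suc i)) (c (punchIn j s)))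

    cofactor≈0 : ∀ j → c (F.suc j) ≤ r F.zero → cofactor (F.suc j) ≈ 0#
    cofactor≈0 j cⱼ≤r₀ = det-zeroColumn-punchIn m (λ i s → M (r (F.suc i)) (c s)) j λ i →
      M-band (r (F.suc i)) (c F.zero)
        (ℕₚ.<-≤-trans (s≤s (ℕₚ.<-≤-trans (c↑ F.zero (F.suc j) (s≤s z≤n)) cⱼ≤r₀)) (r↑ F.zero (F.suc i) (s≤s z≤n)))

    laplaceTerm-nonNeg : ∀ j → NonNegCoeffs (signS (toℕ j) * M (r F.zero) (c j) * cofactor j)
    laplaceTerm-nonNeg F.zero = *S-nonNeg (*S-nonNeg 1S-nonNeg (M≥0 _ _))
      (minor-nonNeg m (r ∘ F.suc) (c ∘ F.suc) (λ i j i<j → r↑ (F.suc i) (F.suc j) (s≤s i<j))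
                                               (λ i j i<j → c↑ (F.suc i) (F.suc j) (s≤s i<j)))
    laplaceTerm-nonNeg (F.suc j) with r F.zero ℕₚ.<? c (F.suc j)
    ... | yes r₀<cⱼ = nonNeg-resp (sym (x≈0⇒s*x*d≈0 (signS (toℕ (F.suc j))) (M (r F.zero) (c (F.suc j))) (cofactor (F.suc j))
                                                     (M-lower _ _ r₀<cⱼ))) 0S-nonNeg
    ... | no  r₀≮cⱼ = nonNeg-resp (sym (d≈0⇒s*x*d≈0 (signS (toℕ (F.suc j))) (M (r F.zero) (c (F.suc j))) (cofactor (F.suc j))
                                                     (cofactor≈0 j (ℕₚ.≮⇒≥ r₀≮cⱼ)))) 0S-nonNeg

lemma2p4 : (Binv : Mat) → LowerTriangular Binv →
    (Binv ⋆ Bq) ≈M IdMat → (Bq ⋆ Binv) ≈M IdMat →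
    ((Binv ⋆ (Lbidiag varA varB varC ⋆ Bq)) ≈M Lbidiag varA varB (varQ *S varA +S varC))
    × CoeffwiseTP (Binv ⋆ (Lbidiag varA varB varC ⋆ Bq))
lemma2p4 Binv _ Binv⋆Bq≈Id _ = conjugate≈Lbidiag , coeffwiseTP-resp conjugate≈L L-coeffwiseTP
  where
  L′ : Mat
  L′ = L varA varB (varQ * varA + varC)

  conjugate≈Lbidiag : (Binv ⋆ (Lbidiag varA varB varC ⋆ Bq)) ≈M Lbidiag varA varB (varQ *S varA +S varC)
  conjugate≈Lbidiag = conjugate-Lbidiag-by-Bq Binv Binv⋆Bq≈Id

  conjugate≈L : (Binv ⋆ (Lbidiag varA varB varC ⋆ Bq)) ≈M L′
  conjugate≈L n k = trans (conjugate≈Lbidiag n k) (Lbidiag≈L varA varB (varQ * varA + varC) n k)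

  L-coeffwiseTP : CoeffwiseTP L′
  L-coeffwiseTP = lowerBidiagonal⇒coeffwiseTP L′ (L-lowerBidiagonal varA varB (varQ * varA + varC))
    (L-nonNeg varA-nonNeg varB-nonNeg (+S-nonNeg (*S-nonNeg varQ-nonNeg varA-nonNeg) varC-nonNeg))
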